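{- Let $(G,L)$ be an uncolorable pair. Then for each block $B$ of $G$ there is a list-assignment $L_B$ of $B$ such that $(B,L_B)$ is an uncolorable pair and $L(v)=\bigcup_{B\in\mathcal{B}_v(G)}L_B(v)$ for all $v\in V(G)$, where $\mathcal{B}_v(G)$ is the set of blocks of $G$ containing $v$.
   Context: A signed graph is a finite graph (multiple edges allowed, no loops) with a sign map $\sigma$ assigning $\pm1$ to each edge; degrees count edges with multiplicity. A coloring is a map $\phi:V\to\mathbb{Z}$ with $\phi(v)\ne\sigma(e)\phi(w)$ for every edge $e$ with ends $v,w$. A list-assignment $L$ assigns a set $L(v)\subseteq\mathbb{Z}$ to each vertex; an $L$-coloring is a coloring with $\phi(v)\in L(v)$. An uncolorable pair is a pair $(G,L)$ where $G$ is a connected signed graph, $|L(v)|\ge d_G(v)$ for all $v$, and $G$ is not $L$-colorable. A block of $G$ is a maximal connected subgraph without a separating vertex. -}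

module Defs where

open import Data.Nat using (ℕ; _≤_)
open import Data.Integer as ℤ using (ℤ; -_)
open import Data.Fin using (Fin; _≟_)
open import Data.Fin.Subset using (Subset; _∈_; _⊆_; ⊤)
open import Data.Fin.Subset.Properties using (_∈?_)
open import Data.List using (List; length; filter; deduplicate; allFin)
open import Data.List.Membership.Propositional using () renaming (_∈_ to _∈ᴸ_)
open import Data.Product using (Σ; ∃; _×_; _,_)
open import Data.Sum using (_⊎_)
open import Relation.Nullary using (¬_; _×-dec_; _⊎-dec_)
open import Relation.Binary.PropositionalEquality using (_≡_; _≢_)

data Sign : Set where
  plus minus : Sign

act : Sign → ℤ → ℤ
act plus  z = z
act minus z = - z

-- A finite signed multigraph on vertex set Fin n: m edges, each with two
-- distinct ends (no loops) and a sign. Parallel edges are allowed.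
record SGraph (n : ℕ) : Set where
  field
    m     : ℕ
    src   : Fin m → Fin n
    tgt   : Fin m → Fin n
    sign  : Fin m → Sign
    noLoop : ∀ e → src e ≢ tgt e
open SGraph public

record Sub {n : ℕ} (G : SGraph n) : Set where
  field
    V : Subset n
    E : Subset (m G)
    closedˢ : ∀ e → e ∈ E → src G e ∈ V
    closedᵗ : ∀ e → e ∈ E → tgt G e ∈ V
open Sub public

Joins : ∀ {n} (G : SGraph n) → Fin (m G) → Fin n → Fin n → Set
Joins G e u w = (src G e ≡ u × tgt G e ≡ w) ⊎ (src G e ≡ w × tgt G e ≡ u)

data Reach {n} (G : SGraph n) (VS : Fin n → Set) (ES : Subset (m G)) : Fin n → Fin n → Set where
  here : ∀ {u} → VS u → Reach G VS ES u u
  step : ∀ {u w v} (e : Fin (m G)) → e ∈ ES → Joins G e u w → VS u →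
         Reach G VS ES w v → Reach G VS ES u v

Connected : ∀ {n} {G : SGraph n} → Sub G → Set
Connected {G = G} H =
  (∃ λ v → v ∈ V H) × (∀ u v → u ∈ V H → v ∈ V H → Reach G (_∈ V H) (E H) u v)

-- x is a separating vertex of H: H − x has (at least) two vertices that are
-- not joined by a walk in H − x (i.e. H − x has more components than H, for connected H).
Separating : ∀ {n} {G : SGraph n} → Sub G → Fin n → Set
Separating {G = G} H x =
  x ∈ V H × (∃ λ u → ∃ λ w → u ∈ V H × w ∈ V H × u ≢ x × w ≢ x ×
     ¬ Reach G (λ y → y ∈ V H × y ≢ x) (E H) u w)

_≤ˢ_ : ∀ {n} {G : SGraph n} → Sub G → Sub G → Set
H ≤ˢ H' = (V H ⊆ V H') × (E H ⊆ E H')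

Nonsep : ∀ {n} {G : SGraph n} → Sub G → Set
Nonsep H = Connected H × (∀ x → ¬ Separating H x)

IsBlock : ∀ {n} {G : SGraph n} → Sub G → Set
IsBlock {G = G} B = Nonsep B × (∀ (H : Sub G) → B ≤ˢ H → Nonsep H → (V H ≡ V B × E H ≡ E B))

whole : ∀ {n} (G : SGraph n) → Sub G
whole G = record { V = ⊤ ; E = ⊤ ; closedˢ = λ _ _ → Data.Fin.Subset.Properties.∈⊤ ; closedᵗ = λ _ _ → Data.Fin.Subset.Properties.∈⊤ }
  where import Data.Fin.Subset.Properties

-- Degree of v in H (edges counted with multiplicity; no loops).
deg : ∀ {n} {G : SGraph n} → Sub G → Fin n → ℕ
deg {G = G} H v =
  length (filter (λ e → (e ∈? E H) ×-dec ((src G e ≟ v) ⊎-dec (tgt G e ≟ v))) (allFin (m G)))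

-- A list-assignment is a map to finite sets of integers, represented by lists
-- (read as sets: membership; size = number of distinct entries).
ListAssignment : ℕ → Set
ListAssignment n = Fin n → List ℤ

card : List ℤ → ℕ
card xs = length (deduplicate ℤ._≟_ xs)

IsLColoring : ∀ {n} {G : SGraph n} → Sub G → ListAssignment n → (Fin n → ℤ) → Set
IsLColoring {G = G} H L φ =
  (∀ v → v ∈ V H → φ v ∈ᴸ L v) ×
  (∀ e → e ∈ E H → φ (src G e) ≢ act (sign G e) (φ (tgt G e)))

Colorable : ∀ {n} {G : SGraph n} → Sub G → ListAssignment n → Set
Colorable H L = ∃ λ φ → IsLColoring H L φ

UncolorablePairSub : ∀ {n} {G : SGraph n} → Sub G → ListAssignment n → Set
UncolorablePairSub H L =
  Connected H × (∀ v → v ∈ V H → deg H v ≤ card (L v)) × ¬ Colorable H L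

UncolorablePair : ∀ {n} (G : SGraph n) → ListAssignment n → Set
UncolorablePair G L = UncolorablePairSub (whole G) L

-- Induction on the number of vertices. Without a separating vertex H is its own only block and
-- L_H = L. Otherwise a separating vertex x splits H into connected H₁ and H₂ meeting only in x. Let
-- A ⊆ L(x) be the colors of x that extend to an L-coloring of H₂ and Ā the others, and replace L(x)
-- by A on H₁ and by Ā on H₂. Both new pairs are uncolorable, and since a connected degree-bounded
-- pair with one vertex of slack is greedily colorable, |A| ≤ d_{H₁}(x) and |Ā| ≤ d_{H₂}(x); as
-- d_{H₁}(x) + d_{H₂}(x) = d_H(x) ≤ |L(x)| ≤ |A| + |Ā|, both pairs are uncolorable pairs. The blocks
-- of H are those of H₁ together with those of H₂, so the two decompositions combine.
module Submission where

open import Defs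
open import Data.Bool.Properties using (T-≡)
open import Data.Empty using (⊥; ⊥-elim)
open import Data.Fin using (Fin; zero; suc; _≟_)
open import Data.Fin.Properties using (any?; all?)
open import Data.Fin.Subset using (Subset; _∈_; _∉_; ∣_∣; ⊤)
open import Data.Fin.Subset.Properties
  using (_∈?_; _⊆?_; ⊆-refl; ⊆-trans; ⊆-antisym; ∈⊤; ∣p∣≤n; p⊂q⇒∣p∣<∣q∣; nonempty?)
open import Data.Integer as ℤ using (ℤ; 0ℤ)
open import Data.Integer.Properties using (neg-involutive)
open import Data.List using (List; []; _∷_; [_]; length; filter; map; _++_; allFin; deduplicate; cartesianProductWith)
open import Data.List.Properties using (filter-≐; length-++; length-map; length-removeAt′)
open import Data.List.Membership.Propositional using (find) renaming (_∈_ to _∈ᴸ_; _∉_ to _∉ᴸ_)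
open import Data.List.Membership.Propositional.Properties
  using (∈-allFin; ∈-map⁺; ∈-filter⁺; ∈-filter⁻; ∈-length; ∈-deduplicate⁻; ∈-deduplicate⁺; ∈-++⁺ˡ; ∈-++⁺ʳ;
         ∈-cartesianProductWith⁺)
open import Data.List.Membership.DecPropositional ℤ._≟_ using () renaming (_∈?_ to _∈ᴸ?_)
import Data.List.Relation.Binary.Sublist.Propositional as Sublist
open import Data.List.Relation.Binary.Sublist.Propositional.Properties using (filter⁺; length-mono-≤)
import Data.List.Relation.Unary.All as All
open import Data.List.Relation.Unary.Any as Any using (here; there; _─_)
open import Data.List.Relation.Unary.Any.Properties using (singleton⁻)
open import Data.List.Relation.Unary.Unique.Propositional using (Unique; _∷_)
open import Data.List.Relation.Unary.Unique.DecPropositional.Properties ℤ._≟_ using (deduplicate-!)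
open import Data.Nat using (ℕ; zero; suc; _+_; _≤_; _<_; z≤n; s≤s; s≤s⁻¹)
open import Data.Nat.Properties
  using (≤-refl; ≤-trans; <⇒≤; <⇒≱; ≮⇒≥; ≤-<-trans; <-≤-trans; +-suc; m<m+n;
         +-cancelʳ-≤; +-cancelˡ-≤; +-monoʳ-≤; +-monoˡ-≤; module ≤-Reasoning)
open import Data.Product using (∃; ∃₂; _×_; _,_; proj₁; proj₂)
open import Data.Sum as Sum using (_⊎_; inj₁; inj₂; [_,_]′)
open import Data.Vec using (tabulate)
open import Data.Vec.Properties using (lookup∘tabulate; []=⇒lookup; lookup⇒[]=)
open import Data.Vec.Functional as Vector using (updateAt)
open import Data.Vec.Functional.Properties using (updateAt-updates; updateAt-minimal)
open import Function using (_∘_; const)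
open import Function.Bundles using (_⇔_; mk⇔; Equivalence)
open import Relation.Nullary using (¬_; Dec; yes; no; ¬?; _×-dec_; _⊎-dec_; _→-dec_)
open import Relation.Nullary.Decidable using (isYes; toWitness; fromWitness; decidable-stable; map′)
open import Relation.Unary using (Decidable)
open import Relation.Binary.PropositionalEquality
  using (_≡_; _≢_; refl; sym; trans; cong; subst; subst₂; module ≡-Reasoning)

-- Counting and cardinalities of lists

module _ {A : Set} where

  count : {P : A → Set} → Decidable P → List A → ℕ
  count P? xs = length (filter P? xs)

  module _ {P Q : A → Set} (P? : Decidable P) (Q? : Decidable Q) where

    count-mono : (∀ {x} → P x → Q x) → ∀ xs → count P? xs ≤ count Q? xs
    count-mono P⇒Q xs = length-mono-≤ (filter⁺ P? Q? (λ { refl → P⇒Q }) (Sublist.⊆-refl {x = xs}))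

    count-cong : (∀ {x} → P x → Q x) → (∀ {x} → Q x → P x) → ∀ xs → count P? xs ≡ count Q? xs
    count-cong P⇒Q Q⇒P xs = cong length (filter-≐ P? Q? (P⇒Q , Q⇒P) xs)

    count-⊎ : (∀ {x} → P x → Q x → ⊥) → ∀ xs →
              count (λ x → P? x ⊎-dec Q? x) xs ≡ count P? xs + count Q? xs
    count-⊎ disjoint [] = refl
    count-⊎ disjoint (x ∷ xs) with P? x | Q? x
    ... | yes p | yes q = ⊥-elim (disjoint p q)
    ... | yes _ | no  _ = cong suc (count-⊎ disjoint xs)
    ... | no  _ | yes _ = trans (cong suc (count-⊎ disjoint xs)) (sym (+-suc _ _))
    ... | no  _ | no  _ = count-⊎ disjoint xs

  count-strict : {P Q : A → Set} (P? : Decidable P) (Q? : Decidable Q) →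
                 (∀ {x} → P x → Q x) → ∀ xs {y} → y ∈ᴸ xs → Q y → ¬ P y → count P? xs < count Q? xs
  count-strict {P} {Q} P? Q? P⇒Q xs {y} y∈xs qy ¬py = begin-strict
    count P? xs                                 <⟨ m<m+n _ (∈-length (∈-filter⁺ Rest? y∈xs (qy , ¬py))) ⟩
    count P? xs + count Rest? xs                ≡⟨ count-⊎ P? Rest? (λ px (_ , ¬px) → ¬px px) xs ⟨
    count (λ x → P? x ⊎-dec Rest? x) xs         ≤⟨ count-mono (λ x → P? x ⊎-dec Rest? x) Q? P∪Rest⇒Q xs ⟩
    count Q? xs                                 ∎
    where
    open ≤-Reasoning
    Rest? : Decidable (λ x → Q x × ¬ P x)
    Rest? x = Q? x ×-dec ¬? (P? x)
    P∪Rest⇒Q : ∀ {x} → P x ⊎ (Q x × ¬ P x) → Q x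
    P∪Rest⇒Q (inj₁ px) = P⇒Q px
    P∪Rest⇒Q (inj₂ (qx , _)) = qx

module _ {A : Set} where

  ∈-─ : ∀ {x z : A} ys (x∈ys : x ∈ᴸ ys) → z ∈ᴸ ys → z ≢ x → z ∈ᴸ (ys ─ x∈ys)
  ∈-─ (_ ∷ _)  (here refl) (here refl) z≢x = ⊥-elim (z≢x refl)
  ∈-─ (_ ∷ _)  (here refl) (there z∈ys) _  = z∈ys
  ∈-─ (_ ∷ _)  (there _)   (here refl) _   = here refl
  ∈-─ (_ ∷ ys) (there x∈ys) (there z∈ys) z≢x = there (∈-─ ys x∈ys z∈ys z≢x)

  unique-⊆⇒length≤ : ∀ {xs ys : List A} → Unique xs → (∀ {z} → z ∈ᴸ xs → z ∈ᴸ ys) → length xs ≤ length ys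
  unique-⊆⇒length≤ {[]}     _          _     = z≤n
  unique-⊆⇒length≤ {x ∷ xs} {ys} (x∉xs ∷ unique) xs⊆ys =
    subst (suc (length xs) ≤_) (sym (length-removeAt′ ys (Any.index x∈ys)))
      (s≤s (unique-⊆⇒length≤ unique λ z∈xs →
        ∈-─ ys x∈ys (xs⊆ys (there z∈xs)) (λ z≡x → All.lookup x∉xs z∈xs (sym z≡x))))
    where
    x∈ys : x ∈ᴸ ys
    x∈ys = xs⊆ys (here refl)

card≤length : ∀ {xs ys : List ℤ} → (∀ {z} → z ∈ᴸ xs → z ∈ᴸ ys) → card xs ≤ length ys
card≤length {xs} xs⊆ys = unique-⊆⇒length≤ (deduplicate-! xs) (λ z∈ → xs⊆ys (∈-deduplicate⁻ ℤ._≟_ xs z∈))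

card-⊆-∪ : ∀ {xs} ys zs → (∀ {z} → z ∈ᴸ xs → z ∈ᴸ ys ⊎ z ∈ᴸ zs) → card xs ≤ card ys + card zs
card-⊆-∪ {xs} ys zs xs⊆ys∪zs = subst (card xs ≤_) (length-++ (dedup ys)) (card≤length into)
  where
  dedup : List ℤ → List ℤ
  dedup = deduplicate ℤ._≟_
  into : ∀ {z} → z ∈ᴸ xs → z ∈ᴸ dedup ys ++ dedup zs
  into z∈xs with xs⊆ys∪zs z∈xs
  ... | inj₁ z∈ys = ∈-++⁺ˡ (∈-deduplicate⁺ ℤ._≟_ z∈ys)
  ... | inj₂ z∈zs = ∈-++⁺ʳ (dedup ys) (∈-deduplicate⁺ ℤ._≟_ z∈zs)

card-pigeonhole : ∀ xs ys → length ys < card xs → ∃ λ x → x ∈ᴸ xs × x ∉ᴸ ys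
card-pigeonhole xs ys ys<xs with Any.any? (λ x → ¬? (x ∈ᴸ? ys)) xs
... | yes some∉ = find some∉
... | no  ¬some∉ = ⊥-elim (<⇒≱ ys<xs (card≤length xs⊆ys))
  where
  xs⊆ys : ∀ {z} → z ∈ᴸ xs → z ∈ᴸ ys
  xs⊆ys {z} z∈xs with z ∈ᴸ? ys
  ... | yes z∈ys = z∈ys
  ... | no  z∉ys = ⊥-elim (¬some∉ (Any.map (λ { refl → z∉ys }) z∈xs))

module _ {n} {P : Fin n → Set} (P? : Decidable P) where

  toSubset : Subset n
  toSubset = tabulate (λ i → isYes (P? i))

  ∈-toSubset⁺ : ∀ {i} → P i → i ∈ toSubset
  ∈-toSubset⁺ {i} p = lookup⇒[]= i _ (trans (lookup∘tabulate _ i) (Equivalence.to T-≡ (fromWitness p)))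

  ∈-toSubset⁻ : ∀ {i} → i ∈ toSubset → P i
  ∈-toSubset⁻ {i} i∈ = toWitness (Equivalence.from T-≡ (trans (sym (lookup∘tabulate _ i)) ([]=⇒lookup i∈)))

module _ {A : Set} where

  allFunctions : ∀ k → (Fin k → List A) → List (Fin k → A)
  allFunctions zero    _       = [ (λ ()) ]
  allFunctions (suc k) choices =
    cartesianProductWith Vector._∷_ (choices zero) (allFunctions k (λ i → choices (suc i)))

  allFunctions-complete : ∀ k (choices : Fin k → List A) (R : Fin k → A → Set) →
    (∀ i → ∃ λ a → a ∈ᴸ choices i × R i a) → ∃ λ f → f ∈ᴸ allFunctions k choices × (∀ i → R i (f i))
  allFunctions-complete zero    _       _ _    = (λ ()) , here refl , λ ()
  allFunctions-complete (suc k) choices R pick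
    with a , a∈ , Ra ← pick zero
       | f , f∈ , Rf ← allFunctions-complete k (λ i → choices (suc i)) (λ i → R (suc i)) (λ i → pick (suc i))
    = a Vector.∷ f , ∈-cartesianProductWith⁺ Vector._∷_ a∈ f∈ , λ { zero → Ra ; (suc i) → Rf i }

-- Walks, reachability and decidable colorability

act-involutive : ∀ s z → act s (act s z) ≡ z
act-involutive plus  z = refl
act-involutive minus z = neg-involutive z

act-swap : ∀ s {a b} → a ≡ act s b → b ≡ act s a
act-swap s {a} {b} a≡sb = trans (sym (act-involutive s b)) (cong (act s) (sym a≡sb))

Incident : ∀ {n} (G : SGraph n) → Fin (m G) → Fin n → Set
Incident G e v = src G e ≡ v ⊎ tgt G e ≡ v

module _ {n} (G : SGraph n) where

  incident? : ∀ e v → Dec (Incident G e v)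
  incident? e v = (src G e ≟ v) ⊎-dec (tgt G e ≟ v)

  joins-sym : ∀ {e a b} → Joins G e a b → Joins G e b a
  joins-sym (inj₁ ends) = inj₂ ends
  joins-sym (inj₂ ends) = inj₁ ends

  joins? : ∀ e a b → Dec (Joins G e a b)
  joins? e a b = ((src G e ≟ a) ×-dec (tgt G e ≟ b)) ⊎-dec ((src G e ≟ b) ×-dec (tgt G e ≟ a))

  joins⇒incident : ∀ {e a b} → Joins G e a b → Incident G e a
  joins⇒incident (inj₁ (src≡a , _)) = inj₁ src≡a
  joins⇒incident (inj₂ (_ , tgt≡a)) = inj₂ tgt≡a

  joins-ends : ∀ {e a b} (Q : Fin n → Set) → Joins G e a b → Q a → Q b → Q (src G e) × Q (tgt G e)
  joins-ends Q (inj₁ (refl , refl)) qa qb = qa , qb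
  joins-ends Q (inj₂ (refl , refl)) qa qb = qb , qa

  joins-irreflexive : ∀ {e a} → ¬ Joins G e a a
  joins-irreflexive {e} (inj₁ (src≡a , tgt≡a)) = noLoop G e (trans src≡a (sym tgt≡a))
  joins-irreflexive {e} (inj₂ (src≡a , tgt≡a)) = noLoop G e (trans src≡a (sym tgt≡a))

module _ {n} {G : SGraph n} where

  module _ {VS : Fin n → Set} {ES : Subset (m G)} where

    reach-source : ∀ {u v} → Reach G VS ES u v → VS u
    reach-source (here vu)          = vu
    reach-source (step _ _ _ vu _) = vu

    reach-target : ∀ {u v} → Reach G VS ES u v → VS v
    reach-target (here vv)         = vv
    reach-target (step _ _ _ _ r) = reach-target r

    reach-snoc : ∀ {u a b} → Reach G VS ES u a → ∀ e → e ∈ ES → Joins G e a b → VS b → Reach G VS ES u b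
    reach-snoc (here va)           e e∈ j vb = step e e∈ j va (here vb)
    reach-snoc (step f f∈ j′ vu r) e e∈ j vb = step f f∈ j′ vu (reach-snoc r e e∈ j vb)

    reach-trans : ∀ {u a v} → Reach G VS ES u a → Reach G VS ES a v → Reach G VS ES u v
    reach-trans (here _)           r = r
    reach-trans (step f f∈ j vu r₁) r = step f f∈ j vu (reach-trans r₁ r)

    reach-sym : ∀ {u v} → Reach G VS ES u v → Reach G VS ES v u
    reach-sym (here vu)          = here vu
    reach-sym (step e e∈ j vu r) = reach-snoc (reach-sym r) e e∈ (joins-sym G j) vu

  reach-mono : ∀ {VS VS′ : Fin n → Set} {ES ES′ : Subset (m G)} →
    (∀ {y} → VS y → VS′ y) → (∀ {e} → e ∈ ES → e ∈ ES′) → ∀ {u v} → Reach G VS ES u v → Reach G VS′ ES′ u v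
  reach-mono VS⇒ ES⇒ (here vu)          = here (VS⇒ vu)
  reach-mono VS⇒ ES⇒ (step e e∈ j vu r) = step e (ES⇒ e∈) j (VS⇒ vu) (reach-mono VS⇒ ES⇒ r)

  -- Breadth-first search: the balls of radius k around u grow strictly until they stabilise, so they
  -- are stable from radius n on.
  module _ {VS : Fin n → Set} (VS? : Decidable VS) (ES : Subset (m G)) (u : Fin n) where

    private
      Within : ℕ → Fin n → Set
      Within zero    y = y ≡ u × VS u
      Within (suc k) y = Within k y ⊎ ∃ λ e → e ∈ ES × ∃ λ a → Within k a × Joins G e a y × VS y

      within? : ∀ k → Decidable (Within k)
      within? zero    y = (y ≟ u) ×-dec VS? u
      within? (suc k) y = within? k y ⊎-dec
        any? (λ e → (e ∈? ES) ×-dec any? (λ a → within? k a ×-dec (joins? G e a y ×-dec VS? y)))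

      Stable : ℕ → Set
      Stable k = ∀ {y} → Within (suc k) y → Within k y

      stable-suc : ∀ {k} → Stable k → Stable (suc k)
      stable-suc st (inj₁ w)                           = w
      stable-suc st (inj₂ (e , e∈ , a , wa , j , vy)) = inj₂ (e , e∈ , a , st wa , j , vy)

      stable-or-grows : ∀ k → Stable k ⊎ k ≤ ∣ toSubset (within? k) ∣
      stable-or-grows zero = inj₂ z≤n
      stable-or-grows (suc k) with stable-or-grows k
      ... | inj₁ st = inj₁ (stable-suc st)
      ... | inj₂ k≤ with any? (λ y → within? (suc k) y ×-dec ¬? (within? k y))
      ...   | yes (y , new , ¬old) =
                inj₂ (≤-<-trans k≤ (p⊂q⇒∣p∣<∣q∣
                  (grow , y , ∈-toSubset⁺ (within? (suc k)) new , ¬old ∘ ∈-toSubset⁻ (within? k))))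
        where
        grow : ∀ {y} → y ∈ toSubset (within? k) → y ∈ toSubset (within? (suc k))
        grow = ∈-toSubset⁺ (within? (suc k)) ∘ inj₁ ∘ ∈-toSubset⁻ (within? k)
      ...   | no ¬new = inj₁ (stable-suc λ {y} w → decidable-stable (within? k y) (λ ¬old → ¬new (y , w , ¬old)))

      stable : Stable (suc n)
      stable with stable-or-grows (suc n)
      ... | inj₁ st = st
      ... | inj₂ n< = ⊥-elim (<⇒≱ n< (∣p∣≤n (toSubset (within? (suc n)))))

      within⇒reach : ∀ k {y} → Within k y → Reach G VS ES u y
      within⇒reach zero    (refl , vu)                       = here vu
      within⇒reach (suc k) (inj₁ w)                          = within⇒reach k w
      within⇒reach (suc k) (inj₂ (e , e∈ , a , wa , j , vy)) = reach-snoc (within⇒reach k wa) e e∈ j vy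

      reach⇒within : ∀ {a v} → Within (suc n) a → Reach G VS ES a v → Within (suc n) v
      reach⇒within w (here _)           = w
      reach⇒within w (step e e∈ j _ r) = reach⇒within (stable (inj₂ (e , e∈ , _ , w , j , reach-source r))) r

      start : ∀ k → VS u → Within k u
      start zero    vu = refl , vu
      start (suc k) vu = inj₁ (start k vu)

    reach? : ∀ v → Dec (Reach G VS ES u v)
    reach? v with within? (suc n) v
    ... | yes w = yes (within⇒reach (suc n) w)
    ... | no ¬w = no λ r → ¬w (reach⇒within (start (suc n) (reach-source r)) r)

  isLColoring? : (H : Sub G) (L : ListAssignment n) (φ : Fin n → ℤ) → Dec (IsLColoring H L φ)
  isLColoring? H L φ =
    all? (λ v → (v ∈? V H) →-dec (φ v ∈ᴸ? L v)) ×-dec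
    all? (λ e → (e ∈? E H) →-dec ¬? (φ (src G e) ℤ.≟ act (sign G e) (φ (tgt G e))))

  isLColoring-cong : ∀ (H : Sub G) L {φ ψ} → (∀ {v} → v ∈ V H → φ v ≡ ψ v) → IsLColoring H L φ → IsLColoring H L ψ
  isLColoring-cong H L φ≡ψ (φ∈L , φ-proper) =
    (λ v v∈ → subst (_∈ᴸ L v) (φ≡ψ v∈) (φ∈L v v∈)) ,
    (λ e e∈ → subst₂ (λ a b → a ≢ act (sign G e) b) (φ≡ψ (closedˢ H e e∈)) (φ≡ψ (closedᵗ H e e∈)) (φ-proper e e∈))

  isLColoring-⊆ : ∀ (H : Sub G) {L L′ φ} → (∀ {v c} → v ∈ V H → c ∈ᴸ L v → c ∈ᴸ L′ v) →
    IsLColoring H L φ → IsLColoring H L′ φ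
  isLColoring-⊆ H L⊆L′ (φ∈L , φ-proper) = (λ v v∈ → L⊆L′ v∈ (φ∈L v v∈)) , φ-proper

  -- Enumerates the functions with φ v ∈ 0 ∷ L v; every coloring agrees on V H with one of them.
  colorable? : (H : Sub G) (L : ListAssignment n) → Dec (Colorable H L)
  colorable? H L = map′ sound complete (Any.any? (isLColoring? H L) (allFunctions n choices))
    where
    choices : Fin n → List ℤ
    choices v = 0ℤ ∷ L v
    sound : Any.Any (IsLColoring H L) (allFunctions n choices) → Colorable H L
    sound some = let φ , _ , col = find some in φ , col
    pick : ∀ φ → IsLColoring H L φ → ∀ v → ∃ λ a → a ∈ᴸ choices v × (v ∈ V H → a ≡ φ v)
    pick φ (φ∈L , _) v with v ∈? V H
    ... | yes v∈ = φ v , there (φ∈L v v∈) , λ _ → refl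
    ... | no  v∉ = 0ℤ , here refl , λ v∈ → ⊥-elim (v∉ v∈)
    complete : Colorable H L → Any.Any (IsLColoring H L) (allFunctions n choices)
    complete (φ , col) =
      let f , f∈ , f≡φ = allFunctions-complete n choices (λ v a → v ∈ V H → a ≡ φ v) (pick φ col)
      in Any.map (λ { refl → isLColoring-cong H L (λ v∈ → sym (f≡φ _ v∈)) col }) f∈

-- Degrees, vertex deletion and greedy coloring

module _ {n} {G : SGraph n} where

  subgraph : {PV : Fin n → Set} {PE : Fin (m G) → Set} (PV? : Decidable PV) (PE? : Decidable PE) →
             (∀ {e} → PE e → PV (src G e)) → (∀ {e} → PE e → PV (tgt G e)) → Sub G
  subgraph PV? PE? src∈ tgt∈ = record
    { V = toSubset PV?
    ; E = toSubset PE?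
    ; closedˢ = λ _ e∈ → ∈-toSubset⁺ PV? (src∈ (∈-toSubset⁻ PE? e∈))
    ; closedᵗ = λ _ e∈ → ∈-toSubset⁺ PV? (tgt∈ (∈-toSubset⁻ PE? e∈))
    }

  incidentIn? : (H : Sub G) (v : Fin n) → Decidable (λ e → e ∈ E H × Incident G e v)
  incidentIn? H v e = (e ∈? E H) ×-dec incident? G e v

  incident⇒∈ : ∀ (H : Sub G) {e y} → e ∈ E H → Incident G e y → y ∈ V H
  incident⇒∈ H {e} e∈ (inj₁ refl) = closedˢ H e e∈
  incident⇒∈ H {e} e∈ (inj₂ refl) = closedᵗ H e e∈

  module _ (H′ H : Sub G) (v : Fin n) (sub : ∀ {e} → e ∈ E H′ → Incident G e v → e ∈ E H) where

    deg-mono : deg H′ v ≤ deg H v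
    deg-mono = count-mono (incidentIn? H′ v) (incidentIn? H v) (λ (e∈ , inc) → sub e∈ inc , inc) (allFin (m G))

    deg-strict : ∀ {e} → e ∈ E H → Incident G e v → e ∉ E H′ → deg H′ v < deg H v
    deg-strict {e} e∈ inc e∉ =
      count-strict (incidentIn? H′ v) (incidentIn? H v) (λ (e∈′ , inc′) → sub e∈′ inc′ , inc′)
        (allFin (m G)) (∈-allFin e) (e∈ , inc) (e∉ ∘ proj₁)

    deg-cong : (∀ {e} → e ∈ E H → Incident G e v → e ∈ E H′) → deg H′ v ≡ deg H v
    deg-cong sup = count-cong (incidentIn? H′ v) (incidentIn? H v)
      (λ (e∈ , inc) → sub e∈ inc , inc) (λ (e∈ , inc) → sup e∈ inc , inc) (allFin (m G))

  module _ (H : Sub G) (s : Fin n) where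

    private
      V∖s? : Decidable (λ z → z ∈ V H × z ≢ s)
      V∖s? z = (z ∈? V H) ×-dec ¬? (z ≟ s)

      E∖s? : Decidable (λ e → e ∈ E H × src G e ≢ s × tgt G e ≢ s)
      E∖s? e = (e ∈? E H) ×-dec (¬? (src G e ≟ s) ×-dec ¬? (tgt G e ≟ s))

    delete : Sub G
    delete = subgraph V∖s? E∖s?
      (λ (e∈ , src≢s , _) → closedˢ H _ e∈ , src≢s) (λ (e∈ , _ , tgt≢s) → closedᵗ H _ e∈ , tgt≢s)

    ∈-delete⁺ : ∀ {z} → z ∈ V H → z ≢ s → z ∈ V delete
    ∈-delete⁺ z∈ z≢s = ∈-toSubset⁺ V∖s? (z∈ , z≢s)

    ∈-delete⁻ : ∀ {z} → z ∈ V delete → z ∈ V H × z ≢ s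
    ∈-delete⁻ = ∈-toSubset⁻ V∖s?

    ∈ᴱ-delete⁺ : ∀ {e} → e ∈ E H → src G e ≢ s → tgt G e ≢ s → e ∈ E delete
    ∈ᴱ-delete⁺ e∈ src≢s tgt≢s = ∈-toSubset⁺ E∖s? (e∈ , src≢s , tgt≢s)

    ∈ᴱ-delete⁻ : ∀ {e} → e ∈ E delete → e ∈ E H × src G e ≢ s × tgt G e ≢ s
    ∈ᴱ-delete⁻ = ∈-toSubset⁻ E∖s?

    ∣delete∣<∣V∣ : s ∈ V H → ∣ V delete ∣ < ∣ V H ∣
    ∣delete∣<∣V∣ s∈ = p⊂q⇒∣p∣<∣q∣ (proj₁ ∘ ∈-delete⁻ , s , s∈ , λ s∈′ → proj₂ (∈-delete⁻ s∈′) refl)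

    deg-delete≤ : ∀ v → deg delete v ≤ deg H v
    deg-delete≤ v = deg-mono delete H v (λ e∈ _ → proj₁ (∈ᴱ-delete⁻ e∈))

    deg-delete< : ∀ {e y} → e ∈ E H → Joins G e y s → deg delete y < deg H y
    deg-delete< {e} e∈ j = deg-strict delete H _ (λ e∈ _ → proj₁ (∈ᴱ-delete⁻ e∈)) e∈ (joins⇒incident G j)
      λ e∈′ → let _ , src≢s , tgt≢s = ∈ᴱ-delete⁻ e∈′ in [ src≢s , tgt≢s ]′ (joins⇒incident G (joins-sym G j))

    private
      step-delete : ∀ {z c t} e → e ∈ E H → Joins G e z c → z ∈ V H → z ≢ s → c ≢ s →
        Reach G (_∈ V delete) (E delete) c t → Reach G (_∈ V delete) (E delete) z t
      step-delete e e∈ j z∈ z≢s c≢s =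
        let src≢s , tgt≢s = joins-ends G (_≢ s) j z≢s c≢s
        in step e (∈ᴱ-delete⁺ e∈ src≢s tgt≢s) j (∈-delete⁺ z∈ z≢s)

    reach-delete : ∀ {z t} → Reach G (_∈ V H) (E H) z t → z ≢ s →
      Reach G (_∈ V delete) (E delete) z t ⊎
      ∃₂ λ y e → Reach G (_∈ V delete) (E delete) z y × e ∈ E H × Joins G e y s
    reach-delete (here z∈) z≢s = inj₁ (here (∈-delete⁺ z∈ z≢s))
    reach-delete {z} (step {w = c} e e∈ j z∈ rest) z≢s with c ≟ s
    ... | yes refl = inj₂ (z , e , here (∈-delete⁺ z∈ z≢s) , e∈ , j)
    ... | no  c≢s with reach-delete rest c≢s
    ...   | inj₁ r               = inj₁ (step-delete e e∈ j z∈ z≢s c≢s r)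
    ...   | inj₂ (y , f , r , p) = inj₂ (y , f , step-delete e e∈ j z∈ z≢s c≢s r , p)

  DegreeBounded : Sub G → ListAssignment n → Set
  DegreeBounded H L = ∀ v → v ∈ V H → deg H v ≤ card (L v)

  forbidden : (Fin n → ℤ) → Fin n → Fin (m G) → ℤ
  forbidden φ s e with src G e ≟ s
  ... | yes _ = act (sign G e) (φ (tgt G e))
  ... | no  _ = act (sign G e) (φ (src G e))

  forbidden-src : ∀ φ s e → src G e ≡ s → forbidden φ s e ≡ act (sign G e) (φ (tgt G e))
  forbidden-src φ s e src≡s with src G e ≟ s
  ... | yes _    = refl
  ... | no src≢s = ⊥-elim (src≢s src≡s)

  forbidden-tgt : ∀ φ s e → src G e ≢ s → forbidden φ s e ≡ act (sign G e) (φ (src G e))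
  forbidden-tgt φ s e src≢s with src G e ≟ s
  ... | yes src≡s = ⊥-elim (src≢s src≡s)
  ... | no  _     = refl

  forbiddenAt : Sub G → Fin n → (Fin n → ℤ) → List ℤ
  forbiddenAt H s φ = map (forbidden φ s) (filter (incidentIn? H s) (allFin (m G)))

  isLColoring-extend : ∀ H L s {φ c} → IsLColoring (delete H s) L φ → c ∈ᴸ L s → c ∉ᴸ forbiddenAt H s φ →
    IsLColoring H L (updateAt φ s (const c))
  isLColoring-extend H L s {φ} {c} (φ∈L , φ-proper) c∈L c∉F = ψ∈L , ψ-proper
    where
    open ≡-Reasoning
    ψ : Fin n → ℤ
    ψ = updateAt φ s (const c)
    ψ-s : ψ s ≡ c
    ψ-s = updateAt-updates s φ
    ψ-other : ∀ {z} → z ≢ s → ψ z ≡ φ z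
    ψ-other z≢s = updateAt-minimal _ s φ z≢s
    ψ∈L : ∀ v → v ∈ V H → ψ v ∈ᴸ L v
    ψ∈L v v∈ with v ≟ s
    ... | yes refl = subst (_∈ᴸ L v) (sym ψ-s) c∈L
    ... | no  v≢s  = subst (_∈ᴸ L v) (sym (ψ-other v≢s)) (φ∈L v (∈-delete⁺ H s v∈ v≢s))
    not-forbidden : ∀ {e} → e ∈ E H → Incident G e s → c ≢ forbidden φ s e
    not-forbidden {e} e∈ inc c≡ =
      c∉F (subst (_∈ᴸ forbiddenAt H s φ) (sym c≡)
        (∈-map⁺ (forbidden φ s) (∈-filter⁺ (incidentIn? H s) (∈-allFin e) (e∈ , inc))))
    ψ-proper : ∀ e → e ∈ E H → ψ (src G e) ≢ act (sign G e) (ψ (tgt G e))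
    ψ-proper e e∈ eq with src G e ≟ s | tgt G e ≟ s
    ... | yes src≡s | yes tgt≡s = noLoop G e (trans src≡s (sym tgt≡s))
    ... | yes src≡s | no  tgt≢s = not-forbidden e∈ (inj₁ src≡s) (trans c≡ (sym (forbidden-src φ s e src≡s)))
      where
      c≡ : c ≡ act (sign G e) (φ (tgt G e))
      c≡ = begin
        c                            ≡⟨ sym ψ-s ⟩
        ψ s                          ≡⟨ cong ψ (sym src≡s) ⟩
        ψ (src G e)                  ≡⟨ eq ⟩
        act (sign G e) (ψ (tgt G e)) ≡⟨ cong (act (sign G e)) (ψ-other tgt≢s) ⟩
        act (sign G e) (φ (tgt G e)) ∎
    ... | no  src≢s | yes tgt≡s = not-forbidden e∈ (inj₂ tgt≡s) (trans c≡ (sym (forbidden-tgt φ s e src≢s)))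
      where
      c≡ : c ≡ act (sign G e) (φ (src G e))
      c≡ = act-swap (sign G e) (begin
        φ (src G e)                  ≡⟨ sym (ψ-other src≢s) ⟩
        ψ (src G e)                  ≡⟨ eq ⟩
        act (sign G e) (ψ (tgt G e)) ≡⟨ cong (act (sign G e) ∘ ψ) tgt≡s ⟩
        act (sign G e) (ψ s)         ≡⟨ cong (act (sign G e)) ψ-s ⟩
        act (sign G e) c             ∎)
    ... | no  src≢s | no  tgt≢s = φ-proper e (∈ᴱ-delete⁺ H s e∈ src≢s tgt≢s)
      (trans (sym (ψ-other src≢s)) (trans eq (cong (act (sign G e)) (ψ-other tgt≢s))))

  colorable-extend : ∀ H L s → deg H s < card (L s) → Colorable (delete H s) L → Colorable H L
  colorable-extend H L s slack (φ , col) =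
    let c , c∈L , c∉F = card-pigeonhole (L s) (forbiddenAt H s φ)
                          (subst (_< card (L s)) (sym (length-map _ (filter (incidentIn? H s) (allFin (m G))))) slack)
    in updateAt φ s (const c) , isLColoring-extend H L s col c∈L c∉F

  SlackReachable : Sub G → ListAssignment n → Set
  SlackReachable H L = ∀ y → y ∈ V H → ∃ λ s → Reach G (_∈ V H) (E H) y s × deg H s < card (L s)

  -- Deleting s gives slack to its neighbours, so walks that used to reach slack through s now stop there.
  slackReachable-delete : ∀ H L s → DegreeBounded H L → SlackReachable H L → SlackReachable (delete H s) L
  slackReachable-delete H L s bounded slack z z∈ with ∈-delete⁻ H s z∈
  ... | z∈H , z≢s with slack z z∈H
  ...   | t , z⇝t , t-slack with reach-delete H s z⇝t z≢s
  ...     | inj₁ z⇝t′ = t , z⇝t′ , ≤-<-trans (deg-delete≤ H s t) t-slack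
  ...     | inj₂ (y , e , z⇝y , e∈ , j) =
            y , z⇝y , <-≤-trans (deg-delete< H s e∈ j) (bounded y (proj₁ (∈-delete⁻ H s (reach-target z⇝y))))

  colorable-of-slackReachable : ∀ k H L → ∣ V H ∣ < k → DegreeBounded H L → SlackReachable H L → Colorable H L
  colorable-of-slackReachable (suc k) H L size bounded slack with nonempty? (V H)
  ... | no empty = (λ _ → 0ℤ) , (λ v v∈ → ⊥-elim (empty (v , v∈))) , (λ e e∈ → ⊥-elim (empty (_ , closedˢ H e e∈)))
  ... | yes (y , y∈) =
    let s , y⇝s , s-slack = slack y y∈
    in colorable-extend H L s s-slack
         (colorable-of-slackReachable k (delete H s) L (<-≤-trans (∣delete∣<∣V∣ H s (reach-target y⇝s)) (s≤s⁻¹ size))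
           (λ v v∈ → ≤-trans (deg-delete≤ H s v) (bounded v (proj₁ (∈-delete⁻ H s v∈))))
           (slackReachable-delete H L s bounded slack))

  colorable-of-slack : ∀ H L → Connected H → DegreeBounded H L →
                       ∀ {s} → s ∈ V H → deg H s < card (L s) → Colorable H L
  colorable-of-slack H L (_ , conn) bounded {s} s∈ slack =
    colorable-of-slackReachable (suc ∣ V H ∣) H L ≤-refl bounded (λ y y∈ → s , conn y s y∈ s∈ , slack)

-- Blocks, and graphs glued at a vertex

module _ {n} {G : SGraph n} where

  ≤ˢ-refl : ∀ {H : Sub G} → H ≤ˢ H
  ≤ˢ-refl = ⊆-refl , ⊆-refl

  ≤ˢ-trans : ∀ {H₁ H₂ H₃ : Sub G} → H₁ ≤ˢ H₂ → H₂ ≤ˢ H₃ → H₁ ≤ˢ H₃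
  ≤ˢ-trans (V⊆ , E⊆) (V⊆′ , E⊆′) = ⊆-trans V⊆ V⊆′ , ⊆-trans E⊆ E⊆′

  _≤ˢ?_ : (H₁ H₂ : Sub G) → Dec (H₁ ≤ˢ H₂)
  H₁ ≤ˢ? H₂ = (V H₁ ⊆? V H₂) ×-dec (E H₁ ⊆? E H₂)

  IsBlockOf : Sub G → Sub G → Set
  IsBlockOf H B = B ≤ˢ H × Nonsep B × (∀ K → B ≤ˢ K → K ≤ˢ H → Nonsep K → V K ≡ V B × E K ≡ E B)

  edge : Fin (m G) → Sub G
  edge e = subgraph (incident? G e) (_≟ e) (λ { refl → inj₁ refl }) (λ { refl → inj₂ refl })

  edge-nonsep : ∀ e → Nonsep (edge e)
  edge-nonsep e =
    ((src G e , end⁺ (inj₁ refl)) , λ a b a∈ b∈ → walk (end⁻ a∈) (end⁻ b∈)) ,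
    λ z (z∈ , a , b , a∈ , b∈ , a≢z , b≢z , ¬a⇝b) →
      ¬a⇝b (subst (Reach G _ (E (edge e)) a) (same (end⁻ z∈) (end⁻ a∈) (end⁻ b∈) a≢z b≢z) (here (a∈ , a≢z)))
    where
    end⁺ : ∀ {z} → Incident G e z → z ∈ V (edge e)
    end⁺ = ∈-toSubset⁺ (incident? G e)
    end⁻ : ∀ {z} → z ∈ V (edge e) → Incident G e z
    end⁻ = ∈-toSubset⁻ (incident? G e)
    e∈ : e ∈ E (edge e)
    e∈ = ∈-toSubset⁺ (_≟ e) refl
    walk : ∀ {a b} → Incident G e a → Incident G e b → Reach G (_∈ V (edge e)) (E (edge e)) a b
    walk (inj₁ refl) (inj₁ refl) = here (end⁺ (inj₁ refl))
    walk (inj₂ refl) (inj₂ refl) = here (end⁺ (inj₂ refl))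
    walk (inj₁ refl) (inj₂ refl) = step e e∈ (inj₁ (refl , refl)) (end⁺ (inj₁ refl)) (here (end⁺ (inj₂ refl)))
    walk (inj₂ refl) (inj₁ refl) = step e e∈ (inj₂ (refl , refl)) (end⁺ (inj₂ refl)) (here (end⁺ (inj₁ refl)))
    same : ∀ {z a b} → Incident G e z → Incident G e a → Incident G e b → a ≢ z → b ≢ z → a ≡ b
    same _            (inj₁ refl) (inj₁ refl) _   _   = refl
    same _            (inj₂ refl) (inj₂ refl) _   _   = refl
    same (inj₁ refl) (inj₁ refl) (inj₂ refl) a≢z _   = ⊥-elim (a≢z refl)
    same (inj₂ refl) (inj₁ refl) (inj₂ refl) _   b≢z = ⊥-elim (b≢z refl)
    same (inj₁ refl) (inj₂ refl) (inj₁ refl) _   b≢z = ⊥-elim (b≢z refl)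
    same (inj₂ refl) (inj₂ refl) (inj₁ refl) a≢z _   = ⊥-elim (a≢z refl)

  -- The first edge of a walk from x to another vertex spans a nonseparable subgraph containing B.
  block-nontrivial : ∀ H B {x y} → IsBlockOf H B → Connected H → x ∈ V H → y ∈ V H → y ≢ x →
    (∀ {z} → z ∈ V B → z ≡ x) → (∀ {e} → e ∉ E B) → ⊥
  block-nontrivial H B {x} (_ , _ , maximal) (_ , conn) x∈ y∈ y≢x only-x no-edge = first-step (conn x _ x∈ y∈) y≢x
    where
    first-step : ∀ {y} → Reach G (_∈ V H) (E H) x y → y ≢ x → ⊥
    first-step (here _) y≢x = y≢x refl
    first-step (step {w = c} e e∈ j _ _) _ = joins-irreflexive G (subst (Joins G e x) c≡x j)
      where
      B≤K : B ≤ˢ edge e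
      B≤K = (λ z∈ → ∈-toSubset⁺ (incident? G e) (subst (Incident G e) (sym (only-x z∈)) (joins⇒incident G j))) ,
            (λ f∈ → ⊥-elim (no-edge f∈))
      K≤H : edge e ≤ˢ H
      K≤H = (λ z∈ → incident⇒∈ H e∈ (∈-toSubset⁻ (incident? G e) z∈)) ,
            (λ f∈ → subst (_∈ E H) (sym (∈-toSubset⁻ (_≟ e) f∈)) e∈)
      c≡x : c ≡ x
      c≡x = only-x (subst (c ∈_) (proj₁ (maximal (edge e) B≤K K≤H (edge-nonsep e)))
                     (∈-toSubset⁺ (incident? G e) (joins⇒incident G (joins-sym G j))))

  record Split (H : Sub G) (x : Fin n) (H₁ H₂ : Sub G) : Set where
    field
      H₁≤H       : H₁ ≤ˢ H
      H₂≤H       : H₂ ≤ˢ H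
      cover-V    : ∀ {y} → y ∈ V H → y ∈ V H₁ ⊎ y ∈ V H₂
      cover-E    : ∀ {e} → e ∈ E H → e ∈ E H₁ ⊎ e ∈ E H₂
      meet       : ∀ {y} → y ∈ V H₁ → y ∈ V H₂ → y ≡ x
      x∈₁        : x ∈ V H₁
      x∈₂        : x ∈ V H₂
      connected₁ : Connected H₁
      connected₂ : Connected H₂
      beyond₁    : ∃ λ y → y ∈ V H₁ × y ≢ x
      beyond₂    : ∃ λ y → y ∈ V H₂ × y ≢ x

  split-swap : ∀ {H x H₁ H₂} → Split H x H₁ H₂ → Split H x H₂ H₁
  split-swap s = record
    { H₁≤H = H₂≤H ; H₂≤H = H₁≤H
    ; cover-V = λ y∈ → Sum.swap (cover-V y∈) ; cover-E = λ e∈ → Sum.swap (cover-E e∈)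
    ; meet = λ y∈₂ y∈₁ → meet y∈₁ y∈₂
    ; x∈₁ = x∈₂ ; x∈₂ = x∈₁
    ; connected₁ = connected₂ ; connected₂ = connected₁
    ; beyond₁ = beyond₂ ; beyond₂ = beyond₁
    }
    where open Split s

  module _ {H x H₁ H₂} (split : Split H x H₁ H₂) where
    open Split split

    ∈₂⇒∉₁ : ∀ {y} → y ∈ V H₂ → y ≢ x → y ∉ V H₁
    ∈₂⇒∉₁ y∈₂ y≢x y∈₁ = y≢x (meet y∈₁ y∈₂)

    ∣V₁∣<∣V∣ : ∣ V H₁ ∣ < ∣ V H ∣
    ∣V₁∣<∣V∣ = let y , y∈₂ , y≢x = beyond₂ in
      p⊂q⇒∣p∣<∣q∣ (proj₁ H₁≤H , y , proj₁ H₂≤H y∈₂ , ∈₂⇒∉₁ y∈₂ y≢x)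

    ∉E₂-within-V₁ : ∀ {e} → src G e ∈ V H₁ → tgt G e ∈ V H₁ → e ∉ E H₂
    ∉E₂-within-V₁ {e} src∈₁ tgt∈₁ e∈₂ =
      noLoop G e (trans (meet src∈₁ (closedˢ H₂ e e∈₂)) (sym (meet tgt∈₁ (closedᵗ H₂ e e∈₂))))

    E-disjoint : ∀ {e} → e ∈ E H₁ → e ∈ E H₂ → ⊥
    E-disjoint {e} e∈₁ = ∉E₂-within-V₁ (closedˢ H₁ e e∈₁) (closedᵗ H₁ e e∈₁)

    ∈ᴱ₁-of-ends : ∀ {e} → e ∈ E H → src G e ∈ V H₁ → tgt G e ∈ V H₁ → e ∈ E H₁
    ∈ᴱ₁-of-ends e∈ src∈₁ tgt∈₁ with cover-E e∈
    ... | inj₁ e∈₁ = e∈₁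
    ... | inj₂ e∈₂ = ⊥-elim (∉E₂-within-V₁ src∈₁ tgt∈₁ e∈₂)

    deg-split : ∀ {y} → y ∈ V H₁ → y ≢ x → deg H₁ y ≡ deg H y
    deg-split {y} y∈₁ y≢x = deg-cong H₁ H y (λ e∈₁ _ → proj₂ H₁≤H e∈₁) from-H
      where
      from-H : ∀ {e} → e ∈ E H → Incident G e y → e ∈ E H₁
      from-H e∈ inc with cover-E e∈
      ... | inj₁ e∈₁ = e∈₁
      ... | inj₂ e∈₂ = ⊥-elim (∈₂⇒∉₁ (incident⇒∈ H₂ e∈₂ inc) y≢x y∈₁)

    deg-split-x : deg H x ≡ deg H₁ x + deg H₂ x
    deg-split-x = trans
      (count-cong (incidentIn? H x) (λ e → incidentIn? H₁ x e ⊎-dec incidentIn? H₂ x e)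
        (λ (e∈ , inc) → Sum.map (_, inc) (_, inc) (cover-E e∈))
        [ (λ (e∈₁ , inc) → proj₂ H₁≤H e∈₁ , inc) , (λ (e∈₂ , inc) → proj₂ H₂≤H e∈₂ , inc) ]′
        (allFin (m G)))
      (count-⊎ (incidentIn? H₁ x) (incidentIn? H₂ x) (λ (e∈₁ , _) (e∈₂ , _) → E-disjoint e∈₁ e∈₂) (allFin (m G)))

    -- Walks in H − x cannot leave H₁, since every edge of H₂ at a vertex of H₁ ends at x.
    stays₁ : ∀ K → K ≤ˢ H → ∀ {a z} → a ∈ V H₁ → Reach G (λ y → y ∈ V K × y ≢ x) (E K) a z → z ∈ V H₁
    stays₁ K K≤H a∈₁ (here _) = a∈₁
    stays₁ K K≤H a∈₁ (step e e∈ j (_ , a≢x) rest) with cover-E (proj₂ K≤H e∈)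
    ... | inj₁ e∈₁ = stays₁ K K≤H (incident⇒∈ H₁ e∈₁ (joins⇒incident G (joins-sym G j))) rest
    ... | inj₂ e∈₂ = ⊥-elim (∈₂⇒∉₁ (incident⇒∈ H₂ e∈₂ (joins⇒incident G j)) a≢x a∈₁)

    nonsep-≤₁ : ∀ K {a} → Nonsep K → K ≤ˢ H → a ∈ V K → a ∈ V H₁ → a ≢ x → K ≤ˢ H₁
    nonsep-≤₁ K {a} ((_ , conn) , nosep) K≤H a∈K a∈₁ a≢x = V⊆₁ , E⊆₁
      where
      V⊆₁ : ∀ {z} → z ∈ V K → z ∈ V H₁
      V⊆₁ {z} z∈K with z ≟ x | x ∈? V K
      ... | yes refl | _      = x∈₁
      ... | no z≢x   | yes x∈K = decidable-stable (z ∈? V H₁) λ z∉₁ →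
              nosep x (x∈K , a , z , a∈K , z∈K , a≢x , z≢x , λ a⇝z → z∉₁ (stays₁ K K≤H a∈₁ a⇝z))
      ... | no z≢x   | no x∉K  = stays₁ K K≤H a∈₁
              (reach-mono (λ {y} y∈K → y∈K , λ { refl → x∉K y∈K }) (λ e∈ → e∈) (conn a z a∈K z∈K))
      E⊆₁ : ∀ {e} → e ∈ E K → e ∈ E H₁
      E⊆₁ {e} e∈ = ∈ᴱ₁-of-ends (proj₂ K≤H e∈) (V⊆₁ (closedˢ K e e∈)) (V⊆₁ (closedᵗ K e e∈))

  nonsep-side : ∀ {H x H₁ H₂} K → Split H x H₁ H₂ → Nonsep K → K ≤ˢ H → K ≤ˢ H₁ ⊎ K ≤ˢ H₂
  nonsep-side {x = x} {H₁} {H₂} K split ns K≤H with any? (λ a → (a ∈? V K) ×-dec ((a ∈? V H₁) ×-dec ¬? (a ≟ x)))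
  ... | yes (a , a∈K , a∈₁ , a≢x) = inj₁ (nonsep-≤₁ split K ns K≤H a∈K a∈₁ a≢x)
  ... | no none = inj₂ (V⊆₂ , E⊆₂)
    where
    open Split split
    on-x : ∀ {z} → z ∈ V K → z ∈ V H₁ → z ≡ x
    on-x {z} z∈K z∈₁ = decidable-stable (z ≟ x) (λ z≢x → none (z , z∈K , z∈₁ , z≢x))
    V⊆₂ : ∀ {z} → z ∈ V K → z ∈ V H₂
    V⊆₂ z∈K with cover-V (proj₁ K≤H z∈K)
    ... | inj₁ z∈₁ = subst (_∈ V H₂) (sym (on-x z∈K z∈₁)) x∈₂
    ... | inj₂ z∈₂ = z∈₂
    E⊆₂ : ∀ {e} → e ∈ E K → e ∈ E H₂
    E⊆₂ {e} e∈ = ∈ᴱ₁-of-ends (split-swap split) (proj₂ K≤H e∈) (V⊆₂ (closedˢ K e e∈)) (V⊆₂ (closedᵗ K e e∈))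

  isBlockOf-restrict : ∀ {H H′} B → H′ ≤ˢ H → B ≤ˢ H′ → IsBlockOf H B → IsBlockOf H′ B
  isBlockOf-restrict {H} {H′} B H′≤H B≤H′ (_ , ns , maximal) =
    B≤H′ , ns , λ K B≤K K≤H′ nsK → maximal K B≤K (≤ˢ-trans {K} {H′} {H} K≤H′ H′≤H) nsK

  block-side : ∀ {H x H₁ H₂} → Split H x H₁ H₂ → ∀ B → IsBlockOf H B → IsBlockOf H₁ B ⊎ IsBlockOf H₂ B
  block-side {H} {H₁ = H₁} {H₂} split B block@(B≤H , ns , _) =
    Sum.map (λ B≤₁ → isBlockOf-restrict {H} {H₁} B H₁≤H B≤₁ block)
            (λ B≤₂ → isBlockOf-restrict {H} {H₂} B H₂≤H B≤₂ block)
            (nonsep-side B split ns B≤H)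
    where open Split split

  module _ {H x H₁ H₂} (split : Split H x H₁ H₂) where
    open Split split

    block₁-≰₂ : ∀ B → IsBlockOf H₁ B → ¬ B ≤ˢ H₂
    block₁-≰₂ B block@(B≤₁ , _) B≤₂ =
      let y , y∈₁ , y≢x = beyond₁ in
      block-nontrivial H₁ B block connected₁ x∈₁ y∈₁ y≢x
        (λ z∈ → meet (proj₁ B≤₁ z∈) (proj₁ B≤₂ z∈)) (λ e∈ → E-disjoint split (proj₂ B≤₁ e∈) (proj₂ B≤₂ e∈))

    block-lift₁ : ∀ B → IsBlockOf H₁ B → IsBlockOf H B
    block-lift₁ B block@(B≤₁ , ns , maximal) = ≤ˢ-trans {B} {H₁} {H} B≤₁ H₁≤H , ns , maximal′
      where
      maximal′ : ∀ K → B ≤ˢ K → K ≤ˢ H → Nonsep K → V K ≡ V B × E K ≡ E B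
      maximal′ K B≤K K≤H nsK with nonsep-side K split nsK K≤H
      ... | inj₁ K≤₁ = maximal K B≤K K≤₁ nsK
      ... | inj₂ K≤₂ = ⊥-elim (block₁-≰₂ B block (≤ˢ-trans {B} {K} {H₂} B≤K K≤₂))

    isLColoring-cover : ∀ {L ψ} → IsLColoring H₁ L ψ → IsLColoring H₂ L ψ → IsLColoring H L ψ
    isLColoring-cover (ψ∈L₁ , proper₁) (ψ∈L₂ , proper₂) =
      (λ v v∈ → [ ψ∈L₁ v , ψ∈L₂ v ]′ (cover-V v∈)) , (λ e e∈ → [ proper₁ e , proper₂ e ]′ (cover-E e∈))

    colorable-glue : ∀ {L φ₁ φ₂} → IsLColoring H₁ L φ₁ → IsLColoring H₂ L φ₂ → φ₁ x ≡ φ₂ x → Colorable H L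
    colorable-glue {L} {φ₁} {φ₂} col₁ col₂ φ₁x≡φ₂x =
      ψ , isLColoring-cover (isLColoring-cong H₁ L (sym ∘ ψ-on₁) col₁) (isLColoring-cong H₂ L (sym ∘ ψ-on₂) col₂)
      where
      ψ : Fin n → ℤ
      ψ v with v ∈? V H₁
      ... | yes _ = φ₁ v
      ... | no  _ = φ₂ v
      ψ-on₁ : ∀ {v} → v ∈ V H₁ → ψ v ≡ φ₁ v
      ψ-on₁ {v} v∈₁ with v ∈? V H₁
      ... | yes _   = refl
      ... | no v∉₁ = ⊥-elim (v∉₁ v∈₁)
      ψ-on₂ : ∀ {v} → v ∈ V H₂ → ψ v ≡ φ₂ v
      ψ-on₂ {v} v∈₂ with v ∈? V H₁
      ... | yes v∈₁ = subst (λ y → φ₁ y ≡ φ₂ y) (sym (meet v∈₁ v∈₂)) φ₁x≡φ₂x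
      ... | no  _   = refl

-- H₁ is x together with the component C of u in H − x (and the edges meeting C), H₂ the rest of H.
module SplitAtSeparating {n} {G : SGraph n} (H : Sub G) (conn : Connected H) {x u w : Fin n}
  (x∈H : x ∈ V H) (u∈H : u ∈ V H) (w∈H : w ∈ V H) (u≢x : u ≢ x) (w≢x : w ≢ x)
  (¬u⇝w : ¬ Reach G (λ y → y ∈ V H × y ≢ x) (E H) u w) where

  private
    Avoids : Fin n → Set
    Avoids y = y ∈ V H × y ≢ x

    avoids? : Decidable Avoids
    avoids? y = (y ∈? V H) ×-dec ¬? (y ≟ x)

    ReachH : Fin n → Fin n → Set
    ReachH = Reach G (_∈ V H) (E H)

    C : Subset n
    C = toSubset (reach? {G = G} avoids? (E H) u)

    ∈C⁺ : ∀ {y} → Reach G Avoids (E H) u y → y ∈ C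
    ∈C⁺ = ∈-toSubset⁺ (reach? {G = G} avoids? (E H) u)

    ∈C⁻ : ∀ {y} → y ∈ C → Reach G Avoids (E H) u y
    ∈C⁻ = ∈-toSubset⁻ (reach? {G = G} avoids? (E H) u)

    C-avoids : ∀ {y} → y ∈ C → Avoids y
    C-avoids y∈C = reach-target (∈C⁻ y∈C)

    C-closed : ∀ {a b e} → a ∈ C → e ∈ E H → Joins G e a b → Avoids b → b ∈ C
    C-closed a∈C e∈ j b-avoids = ∈C⁺ (reach-snoc (∈C⁻ a∈C) _ e∈ j b-avoids)

    x-or-C : ∀ {a b e} → a ∈ C → e ∈ E H → Joins G e a b → b ∈ V H → b ≡ x ⊎ b ∈ C
    x-or-C {b = b} a∈C e∈ j b∈ with b ≟ x
    ... | yes b≡x = inj₁ b≡x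
    ... | no  b≢x = inj₂ (C-closed a∈C e∈ j (b∈ , b≢x))

    V₁? : Decidable (λ y → y ≡ x ⊎ y ∈ C)
    V₁? y = (y ≟ x) ⊎-dec (y ∈? C)

    Meets : Fin (m G) → Set
    Meets e = src G e ∈ C ⊎ tgt G e ∈ C

    meets? : Decidable Meets
    meets? e = (src G e ∈? C) ⊎-dec (tgt G e ∈? C)

    E₁? : Decidable (λ e → e ∈ E H × Meets e)
    E₁? e = (e ∈? E H) ×-dec meets? e

    V₂? : Decidable (λ y → y ∈ V H × y ∉ C)
    V₂? y = (y ∈? V H) ×-dec ¬? (y ∈? C)

    E₂? : Decidable (λ e → e ∈ E H × ¬ Meets e)
    E₂? e = (e ∈? E H) ×-dec ¬? (meets? e)

  H₁ : Sub G
  H₁ = subgraph V₁? E₁? src∈ tgt∈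
    where
    src∈ : ∀ {e} → e ∈ E H × Meets e → src G e ≡ x ⊎ src G e ∈ C
    src∈ (_  , inj₁ src∈C) = inj₂ src∈C
    src∈ {e} (e∈ , inj₂ tgt∈C) = x-or-C tgt∈C e∈ (inj₂ (refl , refl)) (closedˢ H e e∈)
    tgt∈ : ∀ {e} → e ∈ E H × Meets e → tgt G e ≡ x ⊎ tgt G e ∈ C
    tgt∈ {e} (e∈ , inj₁ src∈C) = x-or-C src∈C e∈ (inj₁ (refl , refl)) (closedᵗ H e e∈)
    tgt∈ (_  , inj₂ tgt∈C) = inj₂ tgt∈C

  H₂ : Sub G
  H₂ = subgraph V₂? E₂?
    (λ {e} (e∈ , ¬meets) → closedˢ H e e∈ , λ src∈C → ¬meets (inj₁ src∈C))
    (λ {e} (e∈ , ¬meets) → closedᵗ H e e∈ , λ tgt∈C → ¬meets (inj₂ tgt∈C))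

  private
    Reach₁ Reach₂ : Fin n → Fin n → Set
    Reach₁ = Reach G (_∈ V H₁) (E H₁)
    Reach₂ = Reach G (_∈ V H₂) (E H₂)

    ∈₁⁺ : ∀ {y} → y ≡ x ⊎ y ∈ C → y ∈ V H₁
    ∈₁⁺ = ∈-toSubset⁺ V₁?
    ∈₁⁻ : ∀ {y} → y ∈ V H₁ → y ≡ x ⊎ y ∈ C
    ∈₁⁻ = ∈-toSubset⁻ V₁?
    ∈ᴱ₁⁺ : ∀ {e} → e ∈ E H × Meets e → e ∈ E H₁
    ∈ᴱ₁⁺ = ∈-toSubset⁺ E₁?
    ∈ᴱ₁⁻ : ∀ {e} → e ∈ E H₁ → e ∈ E H × Meets e
    ∈ᴱ₁⁻ = ∈-toSubset⁻ E₁?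
    ∈₂⁺ : ∀ {y} → y ∈ V H × y ∉ C → y ∈ V H₂
    ∈₂⁺ = ∈-toSubset⁺ V₂?
    ∈₂⁻ : ∀ {y} → y ∈ V H₂ → y ∈ V H × y ∉ C
    ∈₂⁻ = ∈-toSubset⁻ V₂?
    ∈ᴱ₂⁺ : ∀ {e} → e ∈ E H × ¬ Meets e → e ∈ E H₂
    ∈ᴱ₂⁺ = ∈-toSubset⁺ E₂?
    ∈ᴱ₂⁻ : ∀ {e} → e ∈ E H₂ → e ∈ E H × ¬ Meets e
    ∈ᴱ₂⁻ = ∈-toSubset⁻ E₂?

    x∉C : x ∉ C
    x∉C x∈C = proj₂ (C-avoids x∈C) refl

    u∈C : u ∈ C
    u∈C = ∈C⁺ (here (u∈H , u≢x))

    w∉C : w ∉ C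
    w∉C w∈C = ¬u⇝w (∈C⁻ w∈C)

    meets-of : ∀ {e a} → Incident G e a → a ∈ C → Meets e
    meets-of (inj₁ refl) a∈C = inj₁ a∈C
    meets-of (inj₂ refl) a∈C = inj₂ a∈C

    step₁ : ∀ {a b t} e → e ∈ E H → Joins G e a b → a ∈ C → Reach₁ b t → Reach₁ a t
    step₁ e e∈ j a∈C = step e (∈ᴱ₁⁺ (e∈ , meets-of (joins⇒incident G j) a∈C)) j (∈₁⁺ (inj₂ a∈C))

    walk₁ : ∀ {a y} → a ∈ C → Reach G Avoids (E H) a y → Reach₁ a y
    walk₁ a∈C (here _)               = here (∈₁⁺ (inj₂ a∈C))
    walk₁ a∈C (step e e∈ j _ rest) = step₁ e e∈ j a∈C (walk₁ (C-closed a∈C e∈ j (reach-source rest)) rest)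

    toward-x₁ : ∀ {a z} → a ∈ C → ReachH a z → z ∈ C ⊎ Reach₁ a x
    toward-x₁ a∈C (here _) = inj₁ a∈C
    toward-x₁ a∈C (step e e∈ j _ rest) with x-or-C a∈C e∈ j (reach-source rest)
    ... | inj₁ refl = inj₂ (step₁ e e∈ j a∈C (here (∈₁⁺ (inj₁ refl))))
    ... | inj₂ b∈C with toward-x₁ b∈C rest
    ...   | inj₁ z∈C = inj₁ z∈C
    ...   | inj₂ b⇝x = inj₂ (step₁ e e∈ j a∈C b⇝x)

    from-u₁ : ∀ {y} → y ∈ V H₁ → Reach₁ u y
    from-u₁ y∈₁ with ∈₁⁻ y∈₁
    ... | inj₂ y∈C = walk₁ u∈C (∈C⁻ y∈C)
    ... | inj₁ refl with toward-x₁ u∈C (proj₂ conn u x u∈H x∈H)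
    ...   | inj₁ x∈C = ⊥-elim (x∉C x∈C)
    ...   | inj₂ u⇝x = u⇝x

    -- A walk from outside C to x could only enter C through x.
    toward-x₂ : ∀ {b z} → b ∈ V H₂ → ReachH b z → z ≡ x → Reach₂ b x
    toward-x₂ b∈₂ (here _) refl = here b∈₂
    toward-x₂ {b} b∈₂ (step {w = c} e e∈ j b∈ rest) z≡x with b ≟ x
    ... | yes refl = here b∈₂
    ... | no  b≢x  =
      step e (∈ᴱ₂⁺ (e∈ , [ src∉C , tgt∉C ]′)) j b∈₂ (toward-x₂ (∈₂⁺ (reach-source rest , c∉C)) rest z≡x)
      where
      b∉C : b ∉ C
      b∉C = proj₂ (∈₂⁻ b∈₂)
      c∉C : c ∉ C
      c∉C c∈C = b∉C (C-closed c∈C e∈ (joins-sym G j) (b∈ , b≢x))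
      src∉C : src G e ∉ C
      src∉C = proj₁ (joins-ends G (_∉ C) j b∉C c∉C)
      tgt∉C : tgt G e ∉ C
      tgt∉C = proj₂ (joins-ends G (_∉ C) j b∉C c∉C)

    reaches-x₂ : ∀ {y} → y ∈ V H₂ → Reach₂ y x
    reaches-x₂ y∈₂ = toward-x₂ y∈₂ (proj₂ conn _ x (proj₁ (∈₂⁻ y∈₂)) x∈H) refl

  split : Split H x H₁ H₂
  split = record
    { H₁≤H = (λ y∈₁ → [ (λ { refl → x∈H }) , (λ y∈C → proj₁ (C-avoids y∈C)) ]′ (∈₁⁻ y∈₁)) , (λ e∈₁ → proj₁ (∈ᴱ₁⁻ e∈₁))
    ; H₂≤H = (λ y∈₂ → proj₁ (∈₂⁻ y∈₂)) , (λ e∈₂ → proj₁ (∈ᴱ₂⁻ e∈₂))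
    ; cover-V = cover-V
    ; cover-E = cover-E
    ; meet = λ y∈₁ y∈₂ → [ (λ y≡x → y≡x) , (λ y∈C → ⊥-elim (proj₂ (∈₂⁻ y∈₂) y∈C)) ]′ (∈₁⁻ y∈₁)
    ; x∈₁ = ∈₁⁺ (inj₁ refl)
    ; x∈₂ = ∈₂⁺ (x∈H , x∉C)
    ; connected₁ = (u , ∈₁⁺ (inj₂ u∈C)) , λ a b a∈ b∈ → reach-trans (reach-sym (from-u₁ a∈)) (from-u₁ b∈)
    ; connected₂ = (x , ∈₂⁺ (x∈H , x∉C)) , λ a b a∈ b∈ → reach-trans (reaches-x₂ a∈) (reach-sym (reaches-x₂ b∈))
    ; beyond₁ = u , ∈₁⁺ (inj₂ u∈C) , u≢x
    ; beyond₂ = w , ∈₂⁺ (w∈H , w∉C) , w≢x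
    }
    where
    cover-V : ∀ {y} → y ∈ V H → y ∈ V H₁ ⊎ y ∈ V H₂
    cover-V {y} y∈ with y ∈? C
    ... | yes y∈C = inj₁ (∈₁⁺ (inj₂ y∈C))
    ... | no  y∉C = inj₂ (∈₂⁺ (y∈ , y∉C))
    cover-E : ∀ {e} → e ∈ E H → e ∈ E H₁ ⊎ e ∈ E H₂
    cover-E {e} e∈ with meets? e
    ... | yes meets = inj₁ (∈ᴱ₁⁺ (e∈ , meets))
    ... | no ¬meets = inj₂ (∈ᴱ₂⁺ (e∈ , ¬meets))

split-of-separating : ∀ {n} {G : SGraph n} (H : Sub G) {x} → Connected H → Separating H x →
                      ∃₂ λ H₁ H₂ → Split H x H₁ H₂
split-of-separating H conn (x∈ , u , w , u∈ , w∈ , u≢x , w≢x , ¬u⇝w) = H₁ , H₂ , split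
  where open SplitAtSeparating H conn x∈ u∈ w∈ u≢x w≢x ¬u⇝w

-- Splitting the lists at a separating vertex

+-tight : ∀ {a b c d} → a + b ≤ c + d → c ≤ a → d ≤ b → a ≤ c × b ≤ d
+-tight {a} {b} {c} {d} ab≤cd c≤a d≤b =
  +-cancelʳ-≤ b a c (≤-trans ab≤cd (+-monoʳ-≤ c d≤b)) ,
  +-cancelˡ-≤ a b d (≤-trans ab≤cd (+-monoˡ-≤ d c≤a))

module _ {n} (L : ListAssignment n) (x : Fin n) (S : List ℤ) where

  ∈-updateAt-≡ : ∀ {c} → c ∈ᴸ S → c ∈ᴸ updateAt L x (const S) x
  ∈-updateAt-≡ = subst (_ ∈ᴸ_) (sym (updateAt-updates x L))

  ∈-updateAt-≡⁻ : ∀ {c} → c ∈ᴸ updateAt L x (const S) x → c ∈ᴸ S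
  ∈-updateAt-≡⁻ = subst (_ ∈ᴸ_) (updateAt-updates x L)

  ∈-updateAt-≢ : ∀ {v c} → v ≢ x → c ∈ᴸ L v → c ∈ᴸ updateAt L x (const S) v
  ∈-updateAt-≢ v≢x = subst (_ ∈ᴸ_) (sym (updateAt-minimal _ x L v≢x))

  ∈-updateAt-≢⁻ : ∀ {v c} → v ≢ x → c ∈ᴸ updateAt L x (const S) v → c ∈ᴸ L v
  ∈-updateAt-≢⁻ v≢x = subst (_ ∈ᴸ_) (updateAt-minimal _ x L v≢x)

  ∈-updateAt-⊆ : (∀ {c} → c ∈ᴸ S → c ∈ᴸ L x) → ∀ {v c} → c ∈ᴸ updateAt L x (const S) v → c ∈ᴸ L v
  ∈-updateAt-⊆ S⊆ {v} c∈ with v ≟ x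
  ... | yes refl = S⊆ (∈-updateAt-≡⁻ c∈)
  ... | no  v≢x  = ∈-updateAt-≢⁻ v≢x c∈

  card-updateAt-≢ : ∀ {v} → v ≢ x → card (updateAt L x (const S) v) ≡ card (L v)
  card-updateAt-≢ v≢x = cong card (updateAt-minimal _ x L v≢x)

  card-updateAt-≡ : card (updateAt L x (const S) x) ≡ card S
  card-updateAt-≡ = cong card (updateAt-updates x L)

module _ {n} {G : SGraph n} where

  isLColoring-pin : ∀ (K : Sub G) L {L′ x φ} → (∀ {v c} → v ∈ V K → v ≢ x → c ∈ᴸ L′ v → c ∈ᴸ L v) →
    IsLColoring K L′ φ → IsLColoring K (updateAt L x (const [ φ x ])) φ
  isLColoring-pin K L {x = x} {φ} L′⊆L (φ∈L′ , proper) = φ∈pinned , proper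
    where
    φ∈pinned : ∀ v → v ∈ V K → φ v ∈ᴸ updateAt L x (const [ φ x ]) v
    φ∈pinned v v∈ with v ≟ x
    ... | yes refl = ∈-updateAt-≡ L x [ φ x ] (here refl)
    ... | no  v≢x  = ∈-updateAt-≢ L x [ φ x ] v≢x (L′⊆L v∈ v≢x (φ∈L′ v v∈))

  module _ {H H₁ H₂ : Sub G} {x} (split : Split H x H₁ H₂) where
    open Split split

    degreeBounded-split : ∀ {L} → DegreeBounded H L → ∀ S → deg H₁ x ≤ card S →
                          DegreeBounded H₁ (updateAt L x (const S))
    degreeBounded-split {L} bounded S deg≤S v v∈₁ with v ≟ x
    ... | yes refl = subst (deg H₁ x ≤_) (sym (card-updateAt-≡ L x S)) deg≤S
    ... | no  v≢x  = subst₂ _≤_ (sym (deg-split split v∈₁ v≢x)) (sym (card-updateAt-≢ L x S v≢x))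
                                 (bounded v (proj₁ H₁≤H v∈₁))

  record ListSplit (H H₁ H₂ : Sub G) (L L₁ L₂ : ListAssignment n) : Set where
    field
      L₁⊆L  : ∀ {v c} → c ∈ᴸ L₁ v → c ∈ᴸ L v
      L₂⊆L  : ∀ {v c} → c ∈ᴸ L₂ v → c ∈ᴸ L v
      cover : ∀ {v c} → v ∈ V H → c ∈ᴸ L v → (v ∈ V H₁ × c ∈ᴸ L₁ v) ⊎ (v ∈ V H₂ × c ∈ᴸ L₂ v)

  -- L(x) splits into the colors A of x that extend to an L-coloring of H₂ and the rest Ā; an
  -- L-coloring of H₁ with x colored from A would combine with such an extension.
  module ListsAlongSplit {H H₁ H₂ : Sub G} {x} (split : Split H x H₁ H₂) (L : ListAssignment n) where
    open Split split

    private
      pinned : ℤ → ListAssignment n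
      pinned c = updateAt L x (const [ c ])

      extends? : Decidable (λ c → Colorable H₂ (pinned c))
      extends? c = colorable? H₂ (pinned c)

      A Ā : List ℤ
      A = filter extends? (L x)
      Ā = filter (¬? ∘ extends?) (L x)

    L₁ L₂ : ListAssignment n
    L₁ = updateAt L x (const A)
    L₂ = updateAt L x (const Ā)

    listSplit : ListSplit H H₁ H₂ L L₁ L₂
    listSplit = record
      { L₁⊆L  = ∈-updateAt-⊆ L x A (proj₁ ∘ ∈-filter⁻ extends? {xs = L x})
      ; L₂⊆L  = ∈-updateAt-⊆ L x Ā (proj₁ ∘ ∈-filter⁻ (¬? ∘ extends?) {xs = L x})
      ; cover = cover
      }
      where
      cover : ∀ {v c} → v ∈ V H → c ∈ᴸ L v → (v ∈ V H₁ × c ∈ᴸ L₁ v) ⊎ (v ∈ V H₂ × c ∈ᴸ L₂ v)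
      cover {v} {c} v∈ c∈ with v ≟ x
      cover {c = c} v∈ c∈ | yes refl with extends? c
      ... | yes ext  = inj₁ (x∈₁ , ∈-updateAt-≡ L x A (∈-filter⁺ extends? c∈ ext))
      ... | no  ¬ext = inj₂ (x∈₂ , ∈-updateAt-≡ L x Ā (∈-filter⁺ (¬? ∘ extends?) c∈ ¬ext))
      cover v∈ c∈ | no v≢x with cover-V v∈
      ... | inj₁ v∈₁ = inj₁ (v∈₁ , ∈-updateAt-≢ L x A v≢x c∈)
      ... | inj₂ v∈₂ = inj₂ (v∈₂ , ∈-updateAt-≢ L x Ā v≢x c∈)

    uncolorable₁ : ¬ Colorable H L → ¬ Colorable H₁ L₁
    uncolorable₁ ¬col (φ₁ , col₁) =
      ¬col (colorable-glue split (isLColoring-⊆ H₁ (λ _ → ListSplit.L₁⊆L listSplit) col₁)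
                                 (isLColoring-⊆ H₂ (λ _ → ∈-updateAt-⊆ L x [ φ₁ x ] φ₁x∈L) col₂) φ₁x≡φ₂x)
      where
      φ₁x∈A : φ₁ x ∈ᴸ A
      φ₁x∈A = ∈-updateAt-≡⁻ L x A (proj₁ col₁ x x∈₁)
      φ₁x∈L : ∀ {c} → c ∈ᴸ [ φ₁ x ] → c ∈ᴸ L x
      φ₁x∈L (here refl) = proj₁ (∈-filter⁻ extends? {xs = L x} φ₁x∈A)
      φ₂ : Fin n → ℤ
      φ₂ = proj₁ (proj₂ (∈-filter⁻ extends? {xs = L x} φ₁x∈A))
      col₂ : IsLColoring H₂ (pinned (φ₁ x)) φ₂
      col₂ = proj₂ (proj₂ (∈-filter⁻ extends? {xs = L x} φ₁x∈A))
      φ₁x≡φ₂x : φ₁ x ≡ φ₂ x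
      φ₁x≡φ₂x = sym (singleton⁻ (∈-updateAt-≡⁻ L x [ φ₁ x ] (proj₁ col₂ x x∈₂)))

    uncolorable₂ : ¬ Colorable H₂ L₂
    uncolorable₂ (φ₂ , col₂) =
      proj₂ (∈-filter⁻ (¬? ∘ extends?) {xs = L x} (∈-updateAt-≡⁻ L x Ā (proj₁ col₂ x x∈₂)))
        (φ₂ , isLColoring-pin H₂ L (λ _ v≢x → ∈-updateAt-≢⁻ L x Ā v≢x) col₂)

    -- Neither part can have slack at x (it would be colorable), and together they use up all of L(x).
    uncolorablePairs : UncolorablePairSub H L → UncolorablePairSub H₁ L₁ × UncolorablePairSub H₂ L₂
    uncolorablePairs (_ , bounded , ¬col) =
      (connected₁ , degreeBounded-split split bounded A (proj₁ tight) , uncolorable₁ ¬col) ,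
      (connected₂ , degreeBounded-split (split-swap split) bounded Ā (proj₂ tight) , uncolorable₂)
      where
      A≤deg₁ : card A ≤ deg H₁ x
      A≤deg₁ = ≮⇒≥ λ slack → uncolorable₁ ¬col
        (colorable-of-slack H₁ L₁ connected₁ (degreeBounded-split split bounded A (<⇒≤ slack)) x∈₁
          (subst (deg H₁ x <_) (sym (card-updateAt-≡ L x A)) slack))
      Ā≤deg₂ : card Ā ≤ deg H₂ x
      Ā≤deg₂ = ≮⇒≥ λ slack → uncolorable₂
        (colorable-of-slack H₂ L₂ connected₂ (degreeBounded-split (split-swap split) bounded Ā (<⇒≤ slack)) x∈₂
          (subst (deg H₂ x <_) (sym (card-updateAt-≡ L x Ā)) slack))
      A-or-Ā : ∀ {c} → c ∈ᴸ L x → c ∈ᴸ A ⊎ c ∈ᴸ Ā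
      A-or-Ā {c} c∈ with extends? c
      ... | yes ext  = inj₁ (∈-filter⁺ extends? c∈ ext)
      ... | no  ¬ext = inj₂ (∈-filter⁺ (¬? ∘ extends?) c∈ ¬ext)
      degs≤cards : deg H₁ x + deg H₂ x ≤ card A + card Ā
      degs≤cards = begin
        deg H₁ x + deg H₂ x ≡⟨ deg-split-x split ⟨
        deg H x             ≤⟨ bounded x (proj₁ H₁≤H x∈₁) ⟩
        card (L x)          ≤⟨ card-⊆-∪ A Ā A-or-Ā ⟩
        card A + card Ā     ∎
        where open ≤-Reasoning
      tight : deg H₁ x ≤ card A × deg H₂ x ≤ card Ā
      tight = +-tight degs≤cards A≤deg₁ Ā≤deg₂

-- Block decomposition

module _ {n} {G : SGraph n} where

  BlockDecomposition : Sub G → ListAssignment n → Set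
  BlockDecomposition H L = ∃ λ (LB : Sub G → ListAssignment n) →
    (∀ B → IsBlockOf H B → UncolorablePairSub B (LB B)) ×
    (∀ {v} → v ∈ V H → ∀ c → c ∈ᴸ L v ⇔ (∃ λ B → IsBlockOf H B × v ∈ V B × c ∈ᴸ LB B v))

  uncolorablePair-resp : ∀ (H B : Sub G) {L} → V H ≡ V B → E H ≡ E B → UncolorablePairSub H L → UncolorablePairSub B L
  -- Matching on B's fields lets the equations be solved; UncolorablePairSub only looks at V and E.
  uncolorablePair-resp H record { V = _ ; E = _ } refl refl up = up

  isBlockOf-self : ∀ H → Nonsep H → IsBlockOf H H
  isBlockOf-self H ns = ≤ˢ-refl {G = G} {H} , ns , λ K (V⊆ , E⊆) (V⊆′ , E⊆′) _ → ⊆-antisym V⊆′ V⊆ , ⊆-antisym E⊆′ E⊆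

  blockDecomposition-nonsep : ∀ H {L} → UncolorablePairSub H L → (∀ x → ¬ Separating H x) → BlockDecomposition H L
  blockDecomposition-nonsep H {L} up ¬sep =
    (λ _ → L) , blocks , λ v∈ c → mk⇔ (λ c∈ → H , isBlockOf-self H ns , v∈ , c∈) (λ (_ , _ , _ , c∈) → c∈)
    where
    ns : Nonsep H
    ns = proj₁ up , ¬sep
    blocks : ∀ B → IsBlockOf H B → UncolorablePairSub B L
    blocks B (B≤H , _ , maximal) =
      let V≡ , E≡ = maximal H B≤H (≤ˢ-refl {G = G} {H}) ns in uncolorablePair-resp H B V≡ E≡ up

  blockDecomposition-split : ∀ {H H₁ H₂ x L L₁ L₂} → Split H x H₁ H₂ → ListSplit H H₁ H₂ L L₁ L₂ →
    BlockDecomposition H₁ L₁ → BlockDecomposition H₂ L₂ → BlockDecomposition H L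
  blockDecomposition-split {H} {H₁} {H₂} {L = L} split lists (LB₁ , blocks₁ , lists₁) (LB₂ , blocks₂ , lists₂) =
    LB , blocks , λ v∈ c → mk⇔ (to v∈ c) (from c)
    where
    LB : Sub G → ListAssignment n
    LB B with B ≤ˢ? H₁
    ... | yes _ = LB₁ B
    ... | no  _ = LB₂ B
    LB-₁ : ∀ B → IsBlockOf H₁ B → LB B ≡ LB₁ B
    LB-₁ B (B≤₁ , _) with B ≤ˢ? H₁
    ... | yes _   = refl
    ... | no B≰₁ = ⊥-elim (B≰₁ B≤₁)
    LB-₂ : ∀ B → IsBlockOf H₂ B → LB B ≡ LB₂ B
    LB-₂ B b₂ with B ≤ˢ? H₁
    ... | yes B≤₁ = ⊥-elim (block₁-≰₂ (split-swap split) B b₂ B≤₁)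
    ... | no  _   = refl
    blocks : ∀ B → IsBlockOf H B → UncolorablePairSub B (LB B)
    blocks B b with block-side split B b
    ... | inj₁ b₁ = subst (UncolorablePairSub B) (sym (LB-₁ B b₁)) (blocks₁ B b₁)
    ... | inj₂ b₂ = subst (UncolorablePairSub B) (sym (LB-₂ B b₂)) (blocks₂ B b₂)
    to : ∀ {v} → v ∈ V H → ∀ c → c ∈ᴸ L v → ∃ λ B → IsBlockOf H B × v ∈ V B × c ∈ᴸ LB B v
    to {v} v∈ c c∈ with ListSplit.cover lists v∈ c∈
    ... | inj₁ (v∈₁ , c∈₁) =
      let B , b₁ , v∈B , c∈B = Equivalence.to (lists₁ v∈₁ c) c∈₁
      in B , block-lift₁ split B b₁ , v∈B , subst (λ L′ → c ∈ᴸ L′ v) (sym (LB-₁ B b₁)) c∈B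
    ... | inj₂ (v∈₂ , c∈₂) =
      let B , b₂ , v∈B , c∈B = Equivalence.to (lists₂ v∈₂ c) c∈₂
      in B , block-lift₁ (split-swap split) B b₂ , v∈B , subst (λ L′ → c ∈ᴸ L′ v) (sym (LB-₂ B b₂)) c∈B
    from : ∀ {v} c → (∃ λ B → IsBlockOf H B × v ∈ V B × c ∈ᴸ LB B v) → c ∈ᴸ L v
    from {v} c (B , b , v∈B , c∈B) with block-side split B b
    ... | inj₁ b₁ = ListSplit.L₁⊆L lists (Equivalence.from (lists₁ (proj₁ (proj₁ b₁) v∈B) c)
                      (B , b₁ , v∈B , subst (λ L′ → c ∈ᴸ L′ v) (LB-₁ B b₁) c∈B))
    ... | inj₂ b₂ = ListSplit.L₂⊆L lists (Equivalence.from (lists₂ (proj₁ (proj₁ b₂) v∈B) c)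
                      (B , b₂ , v∈B , subst (λ L′ → c ∈ᴸ L′ v) (LB-₂ B b₂) c∈B))

  separating? : (H : Sub G) → Dec (∃ (Separating H))
  separating? H = any? λ x → (x ∈? V H) ×-dec any? λ u → any? λ w →
    (u ∈? V H) ×-dec ((w ∈? V H) ×-dec (¬? (u ≟ x) ×-dec (¬? (w ≟ x) ×-dec
      ¬? (reach? {G = G} (λ y → (y ∈? V H) ×-dec ¬? (y ≟ x)) (E H) u w))))

  blockDecomposition : ∀ k H L → ∣ V H ∣ < k → UncolorablePairSub H L → BlockDecomposition H L
  blockDecomposition (suc k) H L size up with separating? H
  ... | no ¬sep = blockDecomposition-nonsep H up λ x sep → ¬sep (x , sep)
  ... | yes (x , sep) with split-of-separating H (proj₁ up) sep
  ...   | H₁ , H₂ , split =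
          blockDecomposition-split split listSplit
            (recurse H₁ L₁ (∣V₁∣<∣V∣ split) (proj₁ (uncolorablePairs up)))
            (recurse H₂ L₂ (∣V₁∣<∣V∣ (split-swap split)) (proj₂ (uncolorablePairs up)))
    where
    open ListsAlongSplit split L
    recurse : ∀ H′ L′ → ∣ V H′ ∣ < ∣ V H ∣ → UncolorablePairSub H′ L′ → BlockDecomposition H′ L′
    recurse H′ L′ smaller = blockDecomposition k H′ L′ (<-≤-trans smaller (s≤s⁻¹ size))

isBlock⇒isBlockOf-whole : ∀ {n} {G : SGraph n} (B : Sub G) → IsBlock B → IsBlockOf (whole G) B
isBlock⇒isBlockOf-whole B (ns , maximal) = ((λ _ → ∈⊤) , (λ _ → ∈⊤)) , ns , λ K B≤K _ nsK → maximal K B≤K nsK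

isBlockOf-whole⇒isBlock : ∀ {n} {G : SGraph n} (B : Sub G) → IsBlockOf (whole G) B → IsBlock B
isBlockOf-whole⇒isBlock B (_ , ns , maximal) = ns , λ K B≤K nsK → maximal K B≤K ((λ _ → ∈⊤) , (λ _ → ∈⊤)) nsK

lemma11 : ∀ {n} (G : SGraph n) (L : ListAssignment n) → UncolorablePair G L →
    ∃ λ (LB : Sub G → ListAssignment n) →
    (∀ (B : Sub G) → IsBlock B → UncolorablePairSub B (LB B)) ×
    (∀ (v : Fin n) (x : ℤ) →
    (x ∈ᴸ L v) ⇔ (∃ λ (B : Sub G) → IsBlock B × v ∈ V B × x ∈ᴸ LB B v))
lemma11 {n} G L up =
  let LB , blocks , lists = blockDecomposition (suc n) (whole G) L (s≤s (∣p∣≤n ⊤)) up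
  in LB , (λ B b → blocks B (isBlock⇒isBlockOf-whole B b)) , λ v c → mk⇔
       (λ c∈ → let B , b , v∈B , c∈B = Equivalence.to (lists ∈⊤ c) c∈
               in B , isBlockOf-whole⇒isBlock B b , v∈B , c∈B)
       (λ (B , b , v∈B , c∈B) → Equivalence.from (lists ∈⊤ c) (B , isBlock⇒isBlockOf-whole B b , v∈B , c∈B))
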